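{- Let $\mathcal{G}$ be a finite simple undirected graph. If $H_1$ and $H_2$ are T-twins in $\mathcal{G}$ with disjoint vertex sets $V_1$, $V_2$, then every vertex of $V_1$ is adjacent to every vertex of $V_2$.
   Context: All graphs are finite, undirected, without loops or parallel edges. For a vertex $u$, $\mathcal{N}(u)$ denotes the set of vertices adjacent to $u$. Two induced subgraphs $H_1,H_2$ of $\mathcal{G}$ with vertex sets $V_1,V_2$ are called T-twins if there is a graph isomorphism $\varphi:V_1\to V_2$ between $H_1$ and $H_2$ such that $\mathcal{N}(u)\cup V_1=\mathcal{N}(\varphi(u))\cup V_2$ for all $u\in V_1$. -}

module Defs where

open import Data.Nat using (ℕ)
open import Data.Bool using (Bool; true; false)
open import Data.Fin using (Fin)
open import Data.Fin.Subset using (Subset; _∈_; _∉_; _∪_)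
open import Data.Vec using (tabulate)
open import Data.Product using (Σ; _×_; ∃-syntax)
open import Relation.Binary.PropositionalEquality using (_≡_)
open import Relation.Nullary using (¬_)

record Graph (n : ℕ) : Set where
  field
    adj   : Fin n → Fin n → Bool
    sym   : ∀ u v → adj u v ≡ adj v u
    irrefl : ∀ u → adj u u ≡ false

open Graph public

Adj : ∀ {n} → Graph n → Fin n → Fin n → Set
Adj G u v = adj G u v ≡ true

N : ∀ {n} → Graph n → Fin n → Subset n
N G u = tabulate (λ v → adj G u v)

IsIsoOn : ∀ {n} → Graph n → Subset n → Subset n → (Fin n → Fin n) → Set
IsIsoOn G V₁ V₂ φ =
    (∀ u → u ∈ V₁ → φ u ∈ V₂)
  × (∀ u w → u ∈ V₁ → w ∈ V₁ → φ u ≡ φ w → u ≡ w)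
  × (∀ v → v ∈ V₂ → Σ (Fin _) λ u → u ∈ V₁ × φ u ≡ v)
  × (∀ u w → u ∈ V₁ → w ∈ V₁ → adj G u w ≡ adj G (φ u) (φ w))

TTwins : ∀ {n} → Graph n → Subset n → Subset n → Set
TTwins G V₁ V₂ = ∃[ φ ] (IsIsoOn G V₁ V₂ φ
                       × (∀ u → u ∈ V₁ → N G u ∪ V₁ ≡ N G (φ u) ∪ V₂))

Disjoint : ∀ {n} → Subset n → Subset n → Set
Disjoint V₁ V₂ = ∀ v → v ∈ V₁ → v ∉ V₂

-- Every v ∈ V₂ is φ w for some w ∈ V₁.  Any u ∈ V₁ lies in N(w) ∪ V₁ = N(φ w) ∪ V₂,
-- and since u ∉ V₂ it must be a neighbour of φ w = v.
module Submission where

open import Defs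
open import Data.Fin using (Fin)
open import Data.Fin.Subset using (Subset; _∈_; _∉_; _∪_)
open import Data.Fin.Subset.Properties using (x∈p∪q⁻; x∈p∪q⁺)
open import Data.Vec.Properties using ([]=⇒lookup; lookup∘tabulate)
open import Data.Product using (_,_)
open import Data.Sum using (inj₁; inj₂)
open import Data.Empty using (⊥-elim)
open import Relation.Binary.PropositionalEquality using (_≡_; refl; trans; subst)
  renaming (sym to ≡-sym)

∈N⇒Adj : ∀ {n} (G : Graph n) {u v : Fin n} → v ∈ N G u → Adj G u v
∈N⇒Adj G {u} {v} v∈Nu = trans (≡-sym (lookup∘tabulate (adj G u) v)) ([]=⇒lookup v∈Nu)

Adj-sym : ∀ {n} (G : Graph n) {u v : Fin n} → Adj G u v → Adj G v u
Adj-sym G {u} {v} uv = trans (Graph.sym G v u) uv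

∈N-of-∪≡∪ : ∀ {n} (G : Graph n) {A B : Subset n} {u w x : Fin n} →
  N G u ∪ A ≡ N G w ∪ B → x ∈ A → x ∉ B → x ∈ N G w
∈N-of-∪≡∪ G {A} {B} {u} {w} eq x∈A x∉B
  with x∈p∪q⁻ (N G w) B (subst (_ ∈_) eq (x∈p∪q⁺ {p = N G u} (inj₂ x∈A)))
... | inj₁ x∈Nw = x∈Nw
... | inj₂ x∈B  = ⊥-elim (x∉B x∈B)

corollary6 : ∀ {n} (G : Graph n) (V₁ V₂ : Subset n) →
    TTwins G V₁ V₂ → Disjoint V₁ V₂ →
    ∀ u v → u ∈ V₁ → v ∈ V₂ → Adj G u v
corollary6 G V₁ V₂ (φ , (_ , _ , onto , _) , twin) disjoint u v u∈V₁ v∈V₂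
  with onto v v∈V₂
... | w , w∈V₁ , refl =
  Adj-sym G (∈N⇒Adj G (∈N-of-∪≡∪ G (twin w w∈V₁) u∈V₁ (disjoint u u∈V₁)))
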